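{- Let $\mathcal{P}$ be an $\mathrm{ASP^{fs}}$ program and $\mathcal{Q}$ a query that is finitely recursive on $\mathcal{P}$. Then $\mathrm{DMS}(\mathcal{Q},\mathcal{P})$ is finitely ground.
   Context: Terms are variables or functional terms $f(t_1,\dots,t_k)$ ($k\ge0$). A rule $r$: $a_1 \vee \dots \vee a_n \leftarrow b_1,\dots,b_j,\mathrm{not}\,b_{j+1},\dots,\mathrm{not}\,b_m$ ($n\ge1$); $H(r)$, $B^+(r)$, $B^-(r)$ denote head atoms, positive and negative body atoms, $\mathrm{atoms}(r)$ their union. A program is a finite set of rules; it is stratified if no cycle of predicate dependencies (head predicate depends on body predicates) contains a negative dependency. An $\mathrm{ASP^{fs}}$ program is a stratified program with disjunction and function symbols allowed. A fact is a variable-free rule with empty body and one head atom. A predicate is EDB if all rules defining it are facts, IDB otherwise; $\mathrm{EDB}(\mathcal{P})$ is the set of rules of $\mathcal{P}$ with no IDB predicate in head. $\mathrm{Ground}(\mathcal{P})$ is the set of ground instances over the ground terms built from the function symbols of $\mathcal{P}$. A query is a ground atom $\mathcal{Q}=g(\bar t)$ with function symbols in $\mathcal{P}$. Relevant atoms for $\mathcal{Q}$: $\mathcal{Q}$, and all atoms of $\mathrm{atoms}(r_g)$ for $r_g\in\mathrm{Ground}(\mathcal{P})$ with a relevant head atom; $\mathcal{Q}$ is finitely recursive on $\mathcal{P}$ if finitely many ground atoms are relevant. $\mathrm{DMS}(\mathcal{Q},\mathcal{P})$: with fresh predicates $\mathrm{magic\_}p$ (same arity as $p$), initialize $D=\emptyset$,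 $\mathit{modifiedRules}=\emptyset$, $\mathit{magicRules}=\{\mathrm{magic\_}g(\bar t).\}$, $S=\{g\}$; while $S\neq\emptyset$, move a predicate $p$ from $S$ to $D$, and for each $r\in\mathcal{P}$ and each $p(\bar t)\in H(r)$: add to $\mathit{modifiedRules}$ the rule $r$ with $\mathrm{magic\_}q(\bar s)$ added to the body for every $q(\bar s)\in H(r)$; for each $q(\bar s)\in\mathrm{atoms}(r)\setminus\{p(\bar t)\}$ with $q$ IDB, add $\mathrm{magic\_}q(\bar s)\leftarrow\mathrm{magic\_}p(\bar t)$ to $\mathit{magicRules}$ and add $q$ to $S$ if $q\notin D$. Output $\mathit{magicRules}\cup\mathit{modifiedRules}\cup\mathrm{EDB}(\mathcal{P})$. Finitely ground programs: the dependency graph of a program $\mathcal{P}$ has the IDB predicates as nodes and an edge $q\to p$ if some rule has $p$ in its head and $q$ in its positive body; components are its strongly connected components. The component graph has components as nodes, an edge $C'\to^{+}C$ if some rule has a predicate of $C$ in its head and one of $C'$ in its positive body, and an edge $C'\to^{ - }C$ if there is no $+$ edge from $C'$ to $C$ and some rule has a predicate of $C$ in its head and one of $C'$ in its negative body. A path is weak if it has a $-$ edge, strong otherwise. A component ordering is a total ordering $\gamma=\langle C_1,\dots,C_n\rangle$ of all components such that for $i<j$ there is no strong path from $C_j$ to $C_i$, and if there is a weak path from $C_j$ to $C_i$ then there is a weak path from $C_i$ to $C_j$. The module $P(C_i)$ is the set of rules defining a predicate of $C_i$, excluding those that also define a predicate of some $C_j$, $j<i$. For a set $A$ of ground atoms,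 $\mathrm{Inst}_{P}(A)$ is the set of ground instances $r_g$ of rules of $P$ with $B^+(r_g)\subseteq A$. For sets $T,R$ of ground rules (relative to $C_i$), $\mathrm{Simpl}(T,R)$ is obtained from $T$ by deleting every rule $r_g$ such that $H(r_g)\cup B^-(r_g)$ contains an atom that is a fact in $R$, and then removing from each remaining rule the atoms of $B^+(r_g)$ that are facts in $R$ and each negative literal $\mathrm{not}\,p(\bar t)$ with $p\in C_j$ for some $j<i$ and no rule of $R$ having $p(\bar t)$ in its head. Let $\Phi_{P(C_i),R}(S)=\mathrm{Simpl}(\mathrm{Inst}_{P(C_i)}(A),R)$ where $A$ is the set of atoms occurring in heads of rules of $R\cup S$, and $\Phi^\infty_{P(C_i),R}(\emptyset)$ its least fixpoint. Set $\mathcal{P}^\gamma_0=\mathrm{EDB}(\mathcal{P})$, $\mathcal{P}^\gamma_i=\mathcal{P}^\gamma_{i-1}\cup\Phi^\infty_{P(C_i),\mathcal{P}^\gamma_{i-1}}(\emptyset)$, and $\mathcal{P}^\gamma=\mathcal{P}^\gamma_n$. $\mathcal{P}$ is finitely ground if $\mathcal{P}^\gamma$ is finite for every component ordering $\gamma$ of $\mathcal{P}$. -}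

module Defs where

open import Data.Nat using (ℕ)
open import Data.Fin using (Fin) renaming (_<_ to _<ᶠ_)
open import Data.List using (List; []; _∷_; _++_; length; lookup)
open import Data.List.Relation.Unary.All using (All)
open import Data.List.Relation.Unary.Any using (Any)
open import Data.List.Membership.Propositional using (_∈_)
open import Data.Product using (Σ; ∃; _×_; _,_)
open import Data.Sum using (_⊎_)
open import Data.Empty using (⊥)
open import Relation.Nullary using (¬_)
open import Relation.Binary.PropositionalEquality using (_≡_; _≢_)
open import Relation.Binary.Construct.Closure.ReflexiveTransitive using (Star)
open import Relation.Binary.Construct.Closure.Transitive using (TransClosure)

-- Terms: variables (named by ℕ) and functional terms f(t1,...,tk), k ≥ 0.
-- A function symbol is identified by its name together with its arity.
data Term : Set where
  var : ℕ → Term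
  fn  : ℕ → List Term → Term

record Atom (Pd : Set) : Set where
  constructor atom
  field
    pred : Pd
    args : List Term
open Atom public

record Rule (Pd : Set) : Set where
  constructor rule
  field
    head : List (Atom Pd)
    pos  : List (Atom Pd)
    neg  : List (Atom Pd)
open Rule public

atomsR : ∀ {Pd} → Rule Pd → List (Atom Pd)
atomsR r = head r ++ pos r ++ neg r

-- A (possibly infinite) set of rules.  Finite programs are lists,
-- viewed as sets through membership.
Prog : Set → Set₁
Prog Pd = Rule Pd → Set

_∪_ : ∀ {Pd} → Prog Pd → Prog Pd → Prog Pd
(R ∪ S) r = R r ⊎ S r

∅ : ∀ {Pd} → Prog Pd
∅ _ = ⊥

toProg : ∀ {Pd} → List (Rule Pd) → Prog Pd
toProg P r = r ∈ P

Finite : ∀ {Pd} → Prog Pd → Set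
Finite S = Σ (List _) λ L → ∀ r → S r → r ∈ L

mutual
  substT : (ℕ → Term) → Term → Term
  substT σ (var x)   = σ x
  substT σ (fn f ts) = fn f (substTs σ ts)

  substTs : (ℕ → Term) → List Term → List Term
  substTs σ []       = []
  substTs σ (t ∷ ts) = substT σ t ∷ substTs σ ts

substA : ∀ {Pd} → (ℕ → Term) → Atom Pd → Atom Pd
substA σ (atom p ts) = atom p (substTs σ ts)

substAs : ∀ {Pd} → (ℕ → Term) → List (Atom Pd) → List (Atom Pd)
substAs σ []       = []
substAs σ (a ∷ as) = substA σ a ∷ substAs σ as

substR : ∀ {Pd} → (ℕ → Term) → Rule Pd → Rule Pd
substR σ (rule h p n) = rule (substAs σ h) (substAs σ p) (substAs σ n)

data GroundT : Term → Set where
  fnG : ∀ {f ts} → All GroundT ts → GroundT (fn f ts)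

GroundA : ∀ {Pd} → Atom Pd → Set
GroundA a = All GroundT (args a)

Fact : ∀ {Pd} → Rule Pd → Set
Fact r = Σ _ λ a → head r ≡ a ∷ [] × pos r ≡ [] × neg r ≡ [] × GroundA a

data OccT (f k : ℕ) : Term → Set where
  here  : ∀ {ts} → length ts ≡ k → OccT f k (fn f ts)
  there : ∀ {g ts} → Any (OccT f k) ts → OccT f k (fn g ts)

Sym : ∀ {Pd} → Prog Pd → ℕ → ℕ → Set
Sym P f k = Σ _ λ r → P r × Any (λ a → Any (OccT f k) (args a)) (atomsR r)

data InU {Pd : Set} (P : Prog Pd) : Term → Set where
  mkU : ∀ {f ts} → Sym P f (length ts) → All (InU P) ts → InU P (fn f ts)

GroundInst : ∀ {Pd} → Prog Pd → Rule Pd → Rule Pd → Set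
GroundInst P r rg =
  Σ (ℕ → Term) (λ σ → rg ≡ substR σ r)
  × All (λ a → All (InU P) (args a)) (atomsR rg)

GroundP : ∀ {Pd} → Prog Pd → Prog Pd
GroundP P rg = Σ _ λ r → P r × GroundInst P r rg

Defines : ∀ {Pd} → Rule Pd → Pd → Set
Defines r p = Any (λ a → pred a ≡ p) (head r)

IDB : ∀ {Pd} → Prog Pd → Pd → Set
IDB P p = Σ _ λ r → P r × Defines r p × ¬ Fact r

EDBpred : ∀ {Pd} → Prog Pd → Pd → Set
EDBpred P p = ∀ r → P r → Defines r p → Fact r

EDB : ∀ {Pd} → Prog Pd → Prog Pd
EDB P r = P r × All (λ a → ¬ IDB P (pred a)) (head r)

DepAny : ∀ {Pd} → Prog Pd → Pd → Pd → Set
DepAny P p q = Σ _ λ r → P r × Defines r p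
  × (Any (λ a → pred a ≡ q) (pos r) ⊎ Any (λ a → pred a ≡ q) (neg r))

DepNeg : ∀ {Pd} → Prog Pd → Pd → Pd → Set
DepNeg P p q = Σ _ λ r → P r × Defines r p × Any (λ a → pred a ≡ q) (neg r)

Stratified : ∀ {Pd} → Prog Pd → Set
Stratified P = ∀ p q → DepNeg P p q → ¬ Star (DepAny P) q p

ASPfs : ∀ {Pd} → List (Rule Pd) → Set
ASPfs P = All (λ r → head r ≢ []) P × Stratified (toProg P)

IsQuery : ∀ {Pd} → List (Rule Pd) → Atom Pd → Set
IsQuery P Q = All (InU (toProg P)) (args Q)

data Relevant {Pd : Set} (P : Prog Pd) (Q : Atom Pd) : Atom Pd → Set where
  rel-Q    : Relevant P Q Q
  rel-step : ∀ {rg a b} → GroundP P rg → a ∈ head rg → Relevant P Q a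
           → b ∈ atomsR rg → Relevant P Q b

FinitelyRecursive : ∀ {Pd} → Atom Pd → List (Rule Pd) → Set
FinitelyRecursive Q P =
  Σ (List _) λ L → ∀ a → Relevant (toProg P) Q a → a ∈ L

data MPred : Set where
  orig  : ℕ → MPred
  magic : ℕ → MPred

embA : Atom ℕ → Atom MPred
embA (atom p ts) = atom (orig p) ts

magicA : Atom ℕ → Atom MPred
magicA (atom p ts) = atom (magic p) ts

embAs : List (Atom ℕ) → List (Atom MPred)
embAs []       = []
embAs (a ∷ as) = embA a ∷ embAs as

magicAs : List (Atom ℕ) → List (Atom MPred)
magicAs []       = []
magicAs (a ∷ as) = magicA a ∷ magicAs as

embR : Rule ℕ → Rule MPred
embR (rule h p n) = rule (embAs h) (embAs p) (embAs n)

modifyR : Rule ℕ → Rule MPred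
modifyR (rule h p n) = rule (embAs h) (embAs p ++ magicAs h) (embAs n)

magicRule : Atom ℕ → Atom ℕ → Rule MPred
magicRule qs pt = rule (magicA qs ∷ []) (magicA pt ∷ []) []

-- The set D of predicates processed by the DMS algorithm (the final
-- value of D, which is independent of the order in which S is processed).
data InD (g : ℕ) (P : List (Rule ℕ)) : ℕ → Set where
  d-g    : InD g P g
  d-step : ∀ {p r t q s} → InD g P p → r ∈ P → atom p t ∈ head r
         → atom q s ∈ atomsR r → atom q s ≢ atom p t → IDB (toProg P) q
         → InD g P q

data DMS (Q : Atom ℕ) (P : List (Rule ℕ)) : Prog MPred where
  dms-seed     : DMS Q P (rule (magicA Q ∷ []) [] [])
  dms-modified : ∀ {p r t} → InD (pred Q) P p → r ∈ P → atom p t ∈ head r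
               → DMS Q P (modifyR r)
  dms-magic    : ∀ {p r t q s} → InD (pred Q) P p → r ∈ P → atom p t ∈ head r
               → atom q s ∈ atomsR r → atom q s ≢ atom p t → IDB (toProg P) q
               → DMS Q P (magicRule (atom q s) (atom p t))
  dms-edb      : ∀ {r} → EDB (toProg P) r → DMS Q P (embR r)

data FilterRel {A : Set} (Drop : A → Set) : List A → List A → Set where
  f-[]   : FilterRel Drop [] []
  f-drop : ∀ {x xs ys} → Drop x → FilterRel Drop xs ys → FilterRel Drop (x ∷ xs) ys
  f-keep : ∀ {x xs ys} → ¬ Drop x → FilterRel Drop xs ys
         → FilterRel Drop (x ∷ xs) (x ∷ ys)

module FG {Pd : Set} (P : Prog Pd) where

  DepEdge : Pd → Pd → Set
  DepEdge q p = IDB P q × IDB P p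
    × (Σ _ λ r → P r × Defines r p × Any (λ a → pred a ≡ q) (pos r))

  _∼_ : Pd → Pd → Set
  p ∼ q = IDB P p × IDB P q × Star DepEdge p q × Star DepEdge q p

  -- components are represented by (any) member predicate.
  -- C' →⁺ C
  PosE : Pd → Pd → Set
  PosE c' c = Σ _ λ r → P r
    × Any (λ a → pred a ∼ c) (head r) × Any (λ a → pred a ∼ c') (pos r)

  NegE : Pd → Pd → Set
  NegE c' c = ¬ PosE c' c × (Σ _ λ r → P r
    × Any (λ a → pred a ∼ c) (head r) × Any (λ a → pred a ∼ c') (neg r))

  AnyE : Pd → Pd → Set
  AnyE c' c = PosE c' c ⊎ NegE c' c

  StrongPath : Pd → Pd → Set
  StrongPath = TransClosure PosE

  WeakPath : Pd → Pd → Set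
  WeakPath c c' = Σ _ λ a → Σ _ λ b → Star AnyE c a × NegE a b × Star AnyE b c'

  ComponentOrdering : List Pd → Set
  ComponentOrdering γ =
      (∀ i → IDB P (lookup γ i))
    × (∀ p → IDB P p → Σ (Fin (length γ)) λ i → p ∼ lookup γ i)
    × (∀ i j → lookup γ i ∼ lookup γ j → i ≡ j)
    × (∀ (i j : Fin (length γ)) → i <ᶠ j →
          ¬ StrongPath (lookup γ j) (lookup γ i)
        × (WeakPath (lookup γ j) (lookup γ i) → WeakPath (lookup γ i) (lookup γ j)))

  -- `pre` lists the components C1..C(i-1) preceding the current one c = Ci
  Earlier : List Pd → Pd → Set
  Earlier pre p = Any (λ d → p ∼ d) pre

  Module : List Pd → Pd → Prog Pd
  Module pre c r = P r × Any (λ a → pred a ∼ c) (head r)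
    × ¬ Any (λ a → Earlier pre (pred a)) (head r)

  Inst : List Pd → Pd → (Atom Pd → Set) → Prog Pd
  Inst pre c A rg = Σ _ λ r → Module pre c r × GroundInst P r rg × All A (pos rg)

  FactIn : Prog Pd → Atom Pd → Set
  FactIn R a = R (rule (a ∷ []) [] [])

  Simpl : List Pd → Prog Pd → Prog Pd → Prog Pd
  Simpl pre T R r' = Σ _ λ rg → T rg
    × ¬ Any (FactIn R) (head rg ++ neg rg)
    × head r' ≡ head rg
    × FilterRel (FactIn R) (pos rg) (pos r')
    × FilterRel (λ a → Earlier pre (pred a) × ¬ (Σ _ λ ρ → R ρ × a ∈ head ρ))
                (neg rg) (neg r')

  HeadAtoms : Prog Pd → Atom Pd → Set
  HeadAtoms S a = Σ _ λ ρ → S ρ × a ∈ head ρ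

  Φ : List Pd → Pd → Prog Pd → Prog Pd → Prog Pd
  Φ pre c R S = Simpl pre (Inst pre c (HeadAtoms (R ∪ S))) R

  Φiter : List Pd → Pd → Prog Pd → ℕ → Prog Pd
  Φiter pre c R ℕ.zero    = ∅
  Φiter pre c R (ℕ.suc k) = Φ pre c R (Φiter pre c R k)

  Φ∞ : List Pd → Pd → Prog Pd → Prog Pd
  Φ∞ pre c R rg = Σ ℕ λ k → Φiter pre c R k rg

  stage : List Pd → List Pd → Prog Pd → Prog Pd
  stage pre []       R = R
  stage pre (c ∷ cs) R = stage (pre ++ c ∷ []) cs (R ∪ Φ∞ pre c R)

  Instantiation : List Pd → Prog Pd
  Instantiation γ = stage [] γ (EDB P)

  FinitelyGround : Set
  FinitelyGround = ∀ γ → ComponentOrdering γ → Finite (Instantiation γ)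

FinitelyGround : ∀ {Pd} → Prog Pd → Set
FinitelyGround P = FG.FinitelyGround P

-- Every rule of P^γ is a simplification of a ground instance of a DMS rule whose positive
-- body consists of head atoms of earlier rules.  Along the stages, every head atom magic_p(t̄)
-- has p(t̄) relevant for Q (as soon as the Herbrand universe is inhabited): the seed is
-- magic_Q; a magic rule magic_q(s̄) ← magic_p(t̄) extends to a ground instance of its source
-- rule with p(t̄) in the head and q(s̄) among its atoms; and a modified rule carries magic_a in
-- its body for its head atoms a, so it is an instance of its source rule with a relevant head.
-- Hence every atom of such a rule is a variable-free atom of a DMS rule, or p(t̄) or magic_p(t̄)
-- for one of the finitely many relevant p(t̄), and every rule is at most as long as one of the
-- finitely many DMS rules.

module Submission where

open import Data.Bool using (if_then_else_)
open import Data.Nat using (ℕ; zero; suc; _≤_; z≤n; s≤s)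
open import Data.Nat.Properties using (≤-refl; ≤-reflexive; ≤-trans) renaming (_≟_ to _≟ℕ_)
open import Data.List using (List; []; _∷_; _++_; length; map; concatMap; cartesianProduct; cartesianProductWith)
open import Data.List.Relation.Unary.All as All using (All; []; _∷_)
open import Data.List.Relation.Unary.All.Properties using (++⁺; ++⁻ˡ; ++⁻ʳ)
open import Data.List.Relation.Unary.Any using (Any; here; there)
open import Data.List.Relation.Binary.Sublist.Propositional as Sublist using (_∷ʳ_; _∷_)
open import Data.List.Relation.Binary.Sublist.Propositional.Properties using (All-resp-⊆)
open import Data.List.Relation.Binary.Sublist.Heterogeneous.Properties using (length-mono-≤)
open import Data.List.Membership.Propositional using (_∈_; lose; find)
open import Data.List.Membership.DecPropositional _≟ℕ_ using (_∈?_)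
open import Data.List.Membership.Propositional.Properties
  using (∈-++⁺ˡ; ∈-++⁺ʳ; ∈-++⁻; ∈-map⁺; ∈-concatMap⁺;
         ∈-cartesianProductWith⁺; ∈-cartesianProduct⁺)
open import Data.Product using (Σ; ∃; _×_; _,_; proj₁; proj₂; uncurry)
open import Data.Sum using (_⊎_; inj₁; inj₂; [_,_])
open import Data.Unit using (⊤; tt)
open import Function using (_∘_)
open import Relation.Binary.PropositionalEquality using (_≡_; _≢_; refl; sym; trans; cong; cong₂; subst)
open import Relation.Nullary using (Dec; yes; no; does; contradiction)
open import Relation.Unary using (_⊆_)
open import Defs

listsUpTo : {A : Set} → ℕ → List A → List (List A)
listsUpTo zero    L = [] ∷ []
listsUpTo (suc n) L = [] ∷ cartesianProductWith _∷_ L (listsUpTo n L)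

∈-listsUpTo : {A : Set} {L xs : List A} {n : ℕ} → length xs ≤ n → All (_∈ L) xs → xs ∈ listsUpTo n L
∈-listsUpTo {n = zero}  z≤n      []          = here refl
∈-listsUpTo {n = suc n} z≤n      []          = here refl
∈-listsUpTo             (s≤s le) (x∈ ∷ xs∈) =
  there (∈-cartesianProductWith⁺ _∷_ x∈ (∈-listsUpTo le xs∈))

FilterRel⇒⊆ : {A : Set} {Drop : A → Set} {xs ys : List A} → FilterRel Drop xs ys → ys Sublist.⊆ xs
FilterRel⇒⊆ f-[]          = Sublist.[]
FilterRel⇒⊆ (f-drop _ fr) = _ ∷ʳ FilterRel⇒⊆ fr
FilterRel⇒⊆ (f-keep _ fr) = refl ∷ FilterRel⇒⊆ fr

mutual
  varsT : Term → List ℕ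
  varsT (var x)   = x ∷ []
  varsT (fn f ts) = varsTs ts

  varsTs : List Term → List ℕ
  varsTs []       = []
  varsTs (t ∷ ts) = varsT t ++ varsTs ts

length-substTs : ∀ {σ} ts → length (substTs σ ts) ≡ length ts
length-substTs []       = refl
length-substTs (t ∷ ts) = cong suc (length-substTs ts)

mutual
  substT-cong : ∀ {σ τ} t → (∀ {x} → x ∈ varsT t → σ x ≡ τ x) → substT σ t ≡ substT τ t
  substT-cong (var x)   eq = eq (here refl)
  substT-cong (fn f ts) eq = cong (fn f) (substTs-cong ts eq)

  substTs-cong : ∀ {σ τ} ts → (∀ {x} → x ∈ varsTs ts → σ x ≡ τ x)
               → substTs σ ts ≡ substTs τ ts
  substTs-cong []       eq = refl
  substTs-cong (t ∷ ts) eq =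
    cong₂ _∷_ (substT-cong t (λ x∈ → eq (∈-++⁺ˡ x∈)))
              (substTs-cong ts (λ x∈ → eq (∈-++⁺ʳ (varsT t) x∈)))

mutual
  substT-ground : ∀ σ {t} → GroundT t → substT σ t ≡ t
  substT-ground σ (fnG {f} gs) = cong (fn f) (substTs-ground σ gs)

  substTs-ground : ∀ σ {ts} → All GroundT ts → substTs σ ts ≡ ts
  substTs-ground σ []       = refl
  substTs-ground σ (g ∷ gs) = cong₂ _∷_ (substT-ground σ g) (substTs-ground σ gs)

substA-ground : ∀ {Pd} σ {a : Atom Pd} → GroundA a → substA σ a ≡ a
substA-ground σ {a} g = cong (atom (pred a)) (substTs-ground σ g)

substAs-++ : ∀ {Pd} σ (xs ys : List (Atom Pd)) → substAs σ (xs ++ ys) ≡ substAs σ xs ++ substAs σ ys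
substAs-++ σ []       ys = refl
substAs-++ σ (x ∷ xs) ys = cong (substA σ x ∷_) (substAs-++ σ xs ys)

length-substAs : ∀ {Pd} σ (as : List (Atom Pd)) → length (substAs σ as) ≡ length as
length-substAs σ []       = refl
length-substAs σ (a ∷ as) = cong suc (length-substAs σ as)

∈-substAs⁺ : ∀ {Pd} σ {c : Atom Pd} {as} → c ∈ as → substA σ c ∈ substAs σ as
∈-substAs⁺ σ (here refl) = here refl
∈-substAs⁺ σ (there c∈)  = there (∈-substAs⁺ σ c∈)

All-substAs⁺ : ∀ {Pd} {Pr : Atom Pd → Set} σ as
  → (∀ {c} → c ∈ as → Pr (substA σ c)) → All Pr (substAs σ as)
All-substAs⁺ σ []       pr = []
All-substAs⁺ σ (a ∷ as) pr = pr (here refl) ∷ All-substAs⁺ σ as (λ c∈ → pr (there c∈))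

atomsR-substR : ∀ {Pd} σ (r : Rule Pd) → atomsR (substR σ r) ≡ substAs σ (atomsR r)
atomsR-substR σ (rule h p n) = sym (trans (substAs-++ σ h (p ++ n)) (cong (substAs σ h ++_) (substAs-++ σ p n)))

∈-atomsR-substR⁺ : ∀ {Pd} σ (r : Rule Pd) {c} → c ∈ atomsR r → substA σ c ∈ atomsR (substR σ r)
∈-atomsR-substR⁺ σ r c∈ = subst (_ ∈_) (sym (atomsR-substR σ r)) (∈-substAs⁺ σ c∈)

All-atomsR-substR⁺ : ∀ {Pd} {Pr : Atom Pd → Set} σ (r : Rule Pd)
  → (∀ {c} → c ∈ atomsR r → Pr (substA σ c)) → All Pr (atomsR (substR σ r))
All-atomsR-substR⁺ σ r pr = subst (All _) (sym (atomsR-substR σ r)) (All-substAs⁺ σ (atomsR r) pr)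

rulesWithin : ∀ {Pd} → List (Atom Pd) → Rule Pd → List (Rule Pd)
rulesWithin A ρ =
  cartesianProductWith (λ h → uncurry (rule h)) (listsUpTo (length (head ρ)) A)
    (cartesianProduct (listsUpTo (length (pos ρ)) A) (listsUpTo (length (neg ρ)) A))

∈-rulesWithin : ∀ {Pd} {A : List (Atom Pd)} {ρ r : Rule Pd}
  → length (head r) ≤ length (head ρ) → length (pos r) ≤ length (pos ρ)
  → length (neg r) ≤ length (neg ρ)
  → All (_∈ A) (atomsR r) → r ∈ rulesWithin A ρ
∈-rulesWithin {r = r} h≤ p≤ n≤ atoms∈ =
  ∈-cartesianProductWith⁺ (λ h → uncurry (rule h))
    (∈-listsUpTo h≤ (++⁻ˡ (head r) atoms∈))
    (∈-cartesianProduct⁺ (∈-listsUpTo p≤ (++⁻ˡ (pos r) pn∈))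
                         (∈-listsUpTo n≤ (++⁻ʳ (pos r) pn∈)))
  where pn∈ = ++⁻ʳ (head r) atoms∈

∈-rulesWithin-self : ∀ {Pd} {A : List (Atom Pd)} {ρ : Rule Pd}
  → All (_∈ A) (atomsR ρ) → ρ ∈ rulesWithin A ρ
∈-rulesWithin-self {ρ = ρ} = ∈-rulesWithin {ρ = ρ} ≤-refl ≤-refl ≤-refl

∈-rulesWithin-instance : ∀ {Pd} {A : List (Atom Pd)} σ {ρ r′ : Rule Pd}
  → head r′ ≡ head (substR σ ρ)
  → pos r′ Sublist.⊆ pos (substR σ ρ) → neg r′ Sublist.⊆ neg (substR σ ρ)
  → All (_∈ A) (atomsR (substR σ ρ)) → r′ ∈ rulesWithin A ρ
∈-rulesWithin-instance σ {ρ} {r′} head≡ pos⊆ neg⊆ atoms∈ =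
  ∈-rulesWithin {ρ = ρ}
    (≤-reflexive (trans (cong length head≡) (length-substAs σ (head ρ))))
    (≤-trans (length-mono-≤ pos⊆) (≤-reflexive (length-substAs σ (pos ρ))))
    (≤-trans (length-mono-≤ neg⊆) (≤-reflexive (length-substAs σ (neg ρ))))
    (++⁺ (subst (All _) (sym head≡) (++⁻ˡ (substAs σ (head ρ)) atoms∈))
         (++⁺ (All-resp-⊆ pos⊆ (++⁻ˡ (substAs σ (pos ρ)) body∈))
              (All-resp-⊆ neg⊆ (++⁻ʳ (substAs σ (pos ρ)) body∈))))
  where body∈ = ++⁻ʳ (substAs σ (head ρ)) atoms∈

mutual
  groundT? : ∀ t → Dec (GroundT t)
  groundT? (var x)   = no λ ()
  groundT? (fn f ts) with groundTs? ts
  ... | yes gs = yes (fnG gs)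
  ... | no ¬gs = no λ { (fnG gs) → ¬gs gs }

  groundTs? : ∀ ts → Dec (All GroundT ts)
  groundTs? []       = yes []
  groundTs? (t ∷ ts) with groundT? t | groundTs? ts
  ... | yes g  | yes gs = yes (g ∷ gs)
  ... | no ¬g  | _      = no λ { (g ∷ _) → ¬g g }
  ... | yes _  | no ¬gs = no λ { (_ ∷ gs) → ¬gs gs }

fact? : ∀ {Pd} (r : Rule Pd) → Dec (Fact r)
fact? (rule []            _       _)       = no λ { (_ , () , _) }
fact? (rule (_ ∷ _ ∷ _)   _       _)       = no λ { (_ , () , _) }
fact? (rule (_ ∷ [])      (_ ∷ _) _)       = no λ { (_ , _ , () , _) }
fact? (rule (_ ∷ [])      []      (_ ∷ _)) = no λ { (_ , _ , _ , () , _) }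
fact? (rule (a ∷ [])      []      [])      with groundTs? (args a)
... | yes g  = yes (a , refl , refl , refl , g)
... | no ¬g  = no λ { (_ , refl , _ , _ , g) → ¬g g }

-- Not being IDB only refutes ¬ Fact r; deciding Fact r turns that into a fact.
EDB⇒Fact : ∀ {Pd} {P : Prog Pd} → (∀ {r} → P r → head r ≢ []) → ∀ {r} → EDB P r → Fact r
EDB⇒Fact nonEmpty {rule []      _ _} (Pr , _)       = contradiction refl (nonEmpty Pr)
EDB⇒Fact nonEmpty {rule (a ∷ h) p n} (Pr , ¬idb ∷ _) with fact? (rule (a ∷ h) p n)
... | yes fact = fact
... | no ¬fact = contradiction (_ , Pr , here refl , ¬fact) ¬idb

Fact⇒ground : ∀ {Pd} {r : Rule Pd} {c} → Fact r → c ∈ atomsR r → GroundA c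
Fact⇒ground {r = rule _ _ _} (_ , refl , refl , refl , g) (here refl) = g

module _ {Pd : Set} {P : Prog Pd} where

  mutual
    InU⇒GroundT : ∀ {t} → InU P t → GroundT t
    InU⇒GroundT (mkU _ us) = fnG (InUs⇒GroundTs us)

    InUs⇒GroundTs : ∀ {ts} → All (InU P) ts → All GroundT ts
    InUs⇒GroundTs []       = []
    InUs⇒GroundTs (u ∷ us) = InU⇒GroundT u ∷ InUs⇒GroundTs us

  mutual
    InU⇒Sym : ∀ {f k t} → OccT f k t → InU P t → Sym P f k
    InU⇒Sym {f} (here len) (mkU s _)  = subst (Sym P f) len s
    InU⇒Sym     (there o)  (mkU _ us) = InUs⇒Sym o us

    InUs⇒Sym : ∀ {f k ts} → Any (OccT f k) ts → All (InU P) ts → Sym P f k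
    InUs⇒Sym (here o)  (u ∷ _)  = InU⇒Sym o u
    InUs⇒Sym (there o) (_ ∷ us) = InUs⇒Sym o us

  mutual
    InU-var : ∀ σ {x} t → x ∈ varsT t → InU P (substT σ t) → InU P (σ x)
    InU-var σ (var _)    (here refl) u          = u
    InU-var σ (fn _ ts)  x∈          (mkU _ us) = InUs-var σ ts x∈ us

    InUs-var : ∀ σ {x} ts → x ∈ varsTs ts → All (InU P) (substTs σ ts) → InU P (σ x)
    InUs-var σ (t ∷ ts) x∈ (u ∷ us) with ∈-++⁻ (varsT t) x∈
    ... | inj₁ x∈t  = InU-var σ t x∈t u
    ... | inj₂ x∈ts = InUs-var σ ts x∈ts us

  mutual
    InU-substT : ∀ {σ} → (∀ x → InU P (σ x)) → ∀ t → (∀ {f k} → OccT f k t → Sym P f k)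
               → InU P (substT σ t)
    InU-substT σU (var x)   _       = σU x
    InU-substT σU (fn f ts) symbols =
      mkU (subst (Sym P f) (sym (length-substTs ts)) (symbols (here refl)))
          (InU-substTs σU ts (λ o → symbols (there o)))

    InU-substTs : ∀ {σ} → (∀ x → InU P (σ x)) → ∀ ts → (∀ {f k} → Any (OccT f k) ts → Sym P f k)
                → All (InU P) (substTs σ ts)
    InU-substTs σU []       _       = []
    InU-substTs σU (t ∷ ts) symbols =
      InU-substT σU t (λ o → symbols (here o)) ∷ InU-substTs σU ts (λ o → symbols (there o))

module _ {Pd Pd′ : Set} {P : Prog Pd} {P′ : Prog Pd′} (Sym⊆ : ∀ {f k} → Sym P f k → Sym P′ f k) where
  mutual
    InU-mono : ∀ {t} → InU P t → InU P′ t
    InU-mono (mkU s us) = mkU (Sym⊆ s) (InUs-mono us)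

    InUs-mono : ∀ {ts} → All (InU P) ts → All (InU P′) ts
    InUs-mono []       = []
    InUs-mono (u ∷ us) = InU-mono u ∷ InUs-mono us

module _ {Pd : Set} {P : Prog Pd} where

  groundInstance-agreeing : ∀ σ {r : Rule Pd} {a b} → P r → Σ Term (InU P)
    → a ∈ atomsR r → b ∈ atomsR r
    → All (InU P) (args (substA σ a)) → All (InU P) (args (substA σ b))
    → Σ (ℕ → Term) λ τ → GroundInst P r (substR τ r)
                       × substA τ a ≡ substA σ a × substA τ b ≡ substA σ b
  groundInstance-agreeing σ {r} {a} {b} Pr (d , dU) a∈ b∈ aU bU =
    τ , ((τ , refl) , All-atomsR-substR⁺ τ r τ-InU) , τa≡σa , τb≡σb
    where
      vs : List ℕ
      vs = varsTs (args a) ++ varsTs (args b)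

      τ : ℕ → Term
      τ x = if does (x ∈? vs) then σ x else d

      τ≡σ : ∀ {x} → x ∈ vs → τ x ≡ σ x
      τ≡σ {x} x∈ with x ∈? vs
      ... | yes _  = refl
      ... | no x∉  = contradiction x∈ x∉

      τU : ∀ x → InU P (τ x)
      τU x with x ∈? vs
      ... | no _   = dU
      ... | yes x∈ with ∈-++⁻ (varsTs (args a)) x∈
      ...   | inj₁ x∈a = InUs-var σ (args a) x∈a aU
      ...   | inj₂ x∈b = InUs-var σ (args b) x∈b bU

      τ-InU : ∀ {c} → c ∈ atomsR r → All (InU P) (args (substA τ c))
      τ-InU {c} c∈ =
        InU-substTs τU (args c) (λ {f} {k} o → r , Pr , lose {P = λ c → Any (OccT f k) (args c)} c∈ o)

      τa≡σa : substA τ a ≡ substA σ a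
      τa≡σa = cong (atom (pred a)) (substTs-cong (args a) (λ x∈ → τ≡σ (∈-++⁺ˡ x∈)))

      τb≡σb : substA τ b ≡ substA σ b
      τb≡σb =
        cong (atom (pred b)) (substTs-cong (args b) (λ x∈ → τ≡σ (∈-++⁺ʳ (varsTs (args a)) x∈)))

  Relevant-propagates : ∀ {Q} σ {r : Rule Pd} {a b} → P r → Σ Term (InU P)
    → a ∈ head r → b ∈ atomsR r
    → All (InU P) (args (substA σ a)) → All (InU P) (args (substA σ b))
    → Relevant P Q (substA σ a) → Relevant P Q (substA σ b)
  Relevant-propagates {Q} σ {r} Pr inh a∈ b∈ aU bU rel
    with groundInstance-agreeing σ Pr inh (∈-++⁺ˡ a∈) b∈ aU bU
  ... | τ , inst , τa≡σa , τb≡σb =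
    subst (Relevant P Q) τb≡σb
      (rel-step (r , Pr , inst) (∈-substAs⁺ τ a∈) (subst (Relevant P Q) (sym τa≡σa) rel)
                (∈-atomsR-substR⁺ τ r b∈))

module _ {Pd : Set} (P : Prog Pd) (I : Rule Pd → Set) where
  open FG P

  Instantiation⊆ : EDB P ⊆ I → (∀ pre c {R S} → R ⊆ I → S ⊆ I → Φ pre c R S ⊆ I)
                 → ∀ γ → Instantiation γ ⊆ I
  Instantiation⊆ EDB⊆ Φ⊆ γ = stage⊆ [] γ EDB⊆
    where
      Φiter⊆ : ∀ pre c {R} → R ⊆ I → ∀ k → Φiter pre c R k ⊆ I
      Φiter⊆ pre c R⊆ zero    ()
      Φiter⊆ pre c R⊆ (suc k) = Φ⊆ pre c R⊆ (Φiter⊆ pre c R⊆ k)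

      stage⊆ : ∀ pre γ {R} → R ⊆ I → stage pre γ R ⊆ I
      stage⊆ pre []       R⊆ = R⊆
      stage⊆ pre (c ∷ cs) R⊆ =
        stage⊆ (pre ++ c ∷ []) cs [ R⊆ , (λ { (k , x) → Φiter⊆ pre c R⊆ k x }) ]

embAs-++ : ∀ xs ys → embAs (xs ++ ys) ≡ embAs xs ++ embAs ys
embAs-++ []       ys = refl
embAs-++ (x ∷ xs) ys = cong (embA x ∷_) (embAs-++ xs ys)

substAs-embAs : ∀ σ as → substAs σ (embAs as) ≡ embAs (substAs σ as)
substAs-embAs σ []       = refl
substAs-embAs σ (a ∷ as) = cong (embA (substA σ a) ∷_) (substAs-embAs σ as)

∈-embAs⁺ : ∀ {c as} → c ∈ as → embA c ∈ embAs as
∈-embAs⁺ (here refl) = here refl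
∈-embAs⁺ (there c∈)  = there (∈-embAs⁺ c∈)

∈-embAs⁻ : ∀ {y} as → y ∈ embAs as → ∃ λ c → c ∈ as × y ≡ embA c
∈-embAs⁻ (a ∷ as) (here refl) = a , here refl , refl
∈-embAs⁻ (a ∷ as) (there y∈) with ∈-embAs⁻ as y∈
... | c , c∈ , refl = c , there c∈ , refl

∈-magicAs⁺ : ∀ {c as} → c ∈ as → magicA c ∈ magicAs as
∈-magicAs⁺ (here refl) = here refl
∈-magicAs⁺ (there c∈)  = there (∈-magicAs⁺ c∈)

∈-magicAs⁻ : ∀ {y} as → y ∈ magicAs as → ∃ λ c → c ∈ as × y ≡ magicA c
∈-magicAs⁻ (a ∷ as) (here refl) = a , here refl , refl
∈-magicAs⁻ (a ∷ as) (there y∈) with ∈-magicAs⁻ as y∈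
... | c , c∈ , refl = c , there c∈ , refl

atomsR-embR : ∀ r → atomsR (embR r) ≡ embAs (atomsR r)
atomsR-embR (rule h p n) = sym (trans (embAs-++ h (p ++ n)) (cong (embAs h ++_) (embAs-++ p n)))

∈-atomsR-embR⁻ : ∀ r {y} → y ∈ atomsR (embR r) → ∃ λ c → c ∈ atomsR r × y ≡ embA c
∈-atomsR-embR⁻ r y∈ = ∈-embAs⁻ (atomsR r) (subst (_ ∈_) (atomsR-embR r) y∈)

magicA∈pos-modifyR : ∀ r {a} → a ∈ head r → magicA a ∈ pos (modifyR r)
magicA∈pos-modifyR r a∈ = ∈-++⁺ʳ (embAs (pos r)) (∈-magicAs⁺ a∈)

∈-atomsR-modifyR⁺ : ∀ r {c} → c ∈ atomsR r → embA c ∈ atomsR (modifyR r)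
∈-atomsR-modifyR⁺ (rule h p n) c∈ with ∈-++⁻ h c∈
... | inj₁ c∈h = ∈-++⁺ˡ (∈-embAs⁺ c∈h)
... | inj₂ c∈b with ∈-++⁻ p c∈b
...   | inj₁ c∈p = ∈-++⁺ʳ (embAs h) (∈-++⁺ˡ (∈-++⁺ˡ (∈-embAs⁺ c∈p)))
...   | inj₂ c∈n = ∈-++⁺ʳ (embAs h) (∈-++⁺ʳ (embAs p ++ magicAs h) (∈-embAs⁺ c∈n))

∈-atomsR-modifyR⁻ : ∀ r {y} → y ∈ atomsR (modifyR r)
                  → ∃ λ c → c ∈ atomsR r × (y ≡ embA c ⊎ y ≡ magicA c)
∈-atomsR-modifyR⁻ (rule h p n) y∈ with ∈-++⁻ (embAs h) y∈
... | inj₁ y∈h with ∈-embAs⁻ h y∈h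
...   | c , c∈ , y≡ = c , ∈-++⁺ˡ c∈ , inj₁ y≡
∈-atomsR-modifyR⁻ (rule h p n) y∈ | inj₂ y∈b with ∈-++⁻ (embAs p ++ magicAs h) y∈b
... | inj₂ y∈n with ∈-embAs⁻ n y∈n
...   | c , c∈ , y≡ = c , ∈-++⁺ʳ h (∈-++⁺ʳ p c∈) , inj₁ y≡
∈-atomsR-modifyR⁻ (rule h p n) y∈ | inj₂ y∈b | inj₁ y∈pm with ∈-++⁻ (embAs p) y∈pm
... | inj₁ y∈p with ∈-embAs⁻ p y∈p
...   | c , c∈ , y≡ = c , ∈-++⁺ʳ h (∈-++⁺ˡ c∈) , inj₁ y≡
∈-atomsR-modifyR⁻ (rule h p n) y∈ | inj₂ y∈b | inj₁ y∈pm | inj₂ y∈m with ∈-magicAs⁻ h y∈m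
...   | c , c∈ , y≡ = c , ∈-++⁺ˡ c∈ , inj₂ y≡

module DMSInstantiation (P : List (Rule ℕ)) (Q : Atom ℕ) (asp : ASPfs P)
                        (isQ : IsQuery P Q) (fr : FinitelyRecursive Q P) where

  P′ : Prog ℕ
  P′ = toProg P

  D : Prog MPred
  D = DMS Q P

  Rel : Atom ℕ → Set
  Rel = Relevant P′ Q

  Inhabited : Set
  Inhabited = Σ Term (InU P′)

  args-origin : ∀ {ρ y} → D ρ → y ∈ atomsR ρ
              → args y ≡ args Q
              ⊎ Σ (Rule ℕ) λ r → r ∈ P × ∃ λ a → a ∈ atomsR r × args y ≡ args a
  args-origin dms-seed (here refl) = inj₁ refl
  args-origin (dms-modified {r = r} _ r∈ _) y∈ with ∈-atomsR-modifyR⁻ r y∈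
  ... | c , c∈ , inj₁ refl = inj₂ (r , r∈ , c , c∈ , refl)
  ... | c , c∈ , inj₂ refl = inj₂ (r , r∈ , c , c∈ , refl)
  args-origin (dms-magic {r = r} _ r∈ _ qs∈ _ _) (here refl) = inj₂ (r , r∈ , _ , qs∈ , refl)
  args-origin (dms-magic {r = r} _ r∈ pt∈ _ _ _) (there (here refl)) =
    inj₂ (r , r∈ , _ , ∈-++⁺ˡ pt∈ , refl)
  args-origin (dms-edb {r} (r∈ , _)) y∈ with ∈-atomsR-embR⁻ r y∈
  ... | c , c∈ , refl = inj₂ (r , r∈ , c , c∈ , refl)

  Sym-DMS⊆ : ∀ {f k} → Sym D f k → Sym P′ f k
  Sym-DMS⊆ {f} {k} (ρ , dρ , occ) with find occ
  ... | y , y∈ , o with args-origin dρ y∈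
  ... | inj₁ y≡Q = InUs⇒Sym (subst (Any (OccT f k)) y≡Q o) isQ
  ... | inj₂ (r , r∈ , a , a∈ , y≡a) =
    r , r∈ , lose {P = λ b → Any (OccT f k) (args b)} a∈ (subst (Any (OccT f k)) y≡a o)

  InstanceInU : (ℕ → Term) → Rule MPred → Set
  InstanceInU σ ρ = All (λ a → All (InU D) (args a)) (atomsR (substR σ ρ))

  instance-args : ∀ σ ρ {y} → InstanceInU σ ρ → y ∈ atomsR ρ → All (InU P′) (args (substA σ y))
  instance-args σ ρ inU y∈ = InUs-mono Sym-DMS⊆ (All.lookup inU (∈-atomsR-substR⁺ σ ρ y∈))

  ground-or-inhabited : ∀ σ ρ {y} → InstanceInU σ ρ → y ∈ atomsR ρ → GroundA y ⊎ Inhabited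
  ground-or-inhabited σ ρ {atom _ []}      inU y∈ = inj₁ []
  ground-or-inhabited σ ρ {atom _ (_ ∷ _)} inU y∈ with instance-args σ ρ inU y∈
  ... | u ∷ _ = inj₂ (_ , u)

  -- Over an empty Herbrand universe a magic rule need not extend to a ground instance of its
  -- source rule, so relevance is only claimed once the universe is inhabited.
  Justified : Atom MPred → Set
  Justified (atom (orig _)  _)  = ⊤
  Justified (atom (magic p) ts) = Inhabited → Rel (atom p ts)

  embAs-Justified : ∀ as → All Justified (embAs as)
  embAs-Justified []       = []
  embAs-Justified (_ ∷ as) = tt ∷ embAs-Justified as

  JustifiedBody : (ℕ → Term) → Rule MPred → Set
  JustifiedBody σ ρ = All Justified (pos (substR σ ρ))

  dmsRules : List (Rule MPred)
  dmsRules = rule (magicA Q ∷ []) [] [] ∷ map modifyR P ++ map embR P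
           ++ concatMap (λ r → cartesianProductWith magicRule (atomsR r) (head r)) P

  DMS-listed : D ⊆ (_∈ dmsRules)
  DMS-listed dms-seed                       = here refl
  DMS-listed (dms-modified _ r∈ _)          = there (∈-++⁺ˡ (∈-map⁺ modifyR r∈))
  DMS-listed (dms-edb (r∈ , _))             =
    there (∈-++⁺ʳ (map modifyR P) (∈-++⁺ˡ (∈-map⁺ embR r∈)))
  DMS-listed (dms-magic _ r∈ pt∈ qs∈ _ _) =
    there (∈-++⁺ʳ (map modifyR P) (∈-++⁺ʳ (map embR P)
      (∈-concatMap⁺ (λ r → cartesianProductWith magicRule (atomsR r) (head r))
                    (lose r∈ (∈-cartesianProductWith⁺ magicRule qs∈ pt∈)))))

  -- Variable-free atoms of DMS rules cover the nullary atoms and the atoms of EDB facts.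
  admissibleAtoms : List (Atom MPred)
  admissibleAtoms = concatMap atomsR dmsRules ++ map embA (proj₁ fr) ++ map magicA (proj₁ fr)

  dmsAtom-admissible : ∀ {ρ y} → D ρ → y ∈ atomsR ρ → y ∈ admissibleAtoms
  dmsAtom-admissible dρ y∈ = ∈-++⁺ˡ (∈-concatMap⁺ atomsR (lose (DMS-listed dρ) y∈))

  embA-admissible : ∀ {a} → Rel a → embA a ∈ admissibleAtoms
  embA-admissible rel =
    ∈-++⁺ʳ (concatMap atomsR dmsRules) (∈-++⁺ˡ (∈-map⁺ embA (proj₂ fr _ rel)))

  magicA-admissible : ∀ {a} → Rel a → magicA a ∈ admissibleAtoms
  magicA-admissible rel =
    ∈-++⁺ʳ (concatMap atomsR dmsRules)
      (∈-++⁺ʳ (map embA (proj₁ fr)) (∈-map⁺ magicA (proj₂ fr _ rel)))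

  ground-instance-admissible : ∀ σ {ρ y} → D ρ → y ∈ atomsR ρ → GroundA y
                             → substA σ y ∈ admissibleAtoms
  ground-instance-admissible σ dρ y∈ g =
    subst (_∈ admissibleAtoms) (sym (substA-ground σ g)) (dmsAtom-admissible dρ y∈)

  modified-instance-relevant : ∀ σ {r p t} → Inhabited → r ∈ P → atom p t ∈ head r
    → InstanceInU σ (modifyR r) → JustifiedBody σ (modifyR r)
    → ∀ {c} → c ∈ atomsR r → Rel (substA σ c)
  modified-instance-relevant σ {r} inh r∈ pt∈ inU justified c∈ =
    rel-step (r , r∈ , (σ , refl) , All-atomsR-substR⁺ σ r
               (λ c∈ → instance-args σ (modifyR r) inU (∈-atomsR-modifyR⁺ r c∈)))
      (∈-substAs⁺ σ pt∈)
      (All.lookup justified (∈-substAs⁺ σ (magicA∈pos-modifyR r pt∈)) inh)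
      (∈-atomsR-substR⁺ σ r c∈)

  magic-instance-relevant : ∀ σ {r pt qs} → Inhabited → r ∈ P → pt ∈ head r → qs ∈ atomsR r
    → InstanceInU σ (magicRule qs pt) → JustifiedBody σ (magicRule qs pt) → Rel (substA σ qs)
  magic-instance-relevant σ {pt = pt} {qs} inh r∈ pt∈ qs∈ inU (justified ∷ []) =
    Relevant-propagates {P = P′} σ r∈ inh pt∈ qs∈
      (instance-args σ (magicRule qs pt) inU (there (here refl)))
      (instance-args σ (magicRule qs pt) inU (here refl))
      (justified inh)

  inhabited-instance-admissible : ∀ σ {ρ y} → Inhabited → D ρ → InstanceInU σ ρ → JustifiedBody σ ρ
    → y ∈ atomsR ρ → substA σ y ∈ admissibleAtoms
  inhabited-instance-admissible σ _ dms-seed _ _ (here refl) =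
    ground-instance-admissible σ dms-seed (here refl) (InUs⇒GroundTs isQ)
  inhabited-instance-admissible σ _ dρ@(dms-edb {r} edb) _ _ y∈ with ∈-atomsR-embR⁻ r y∈
  ... | c , c∈ , refl =
    ground-instance-admissible σ dρ y∈ (Fact⇒ground (EDB⇒Fact (All.lookup (proj₁ asp)) edb) c∈)
  inhabited-instance-admissible σ inh (dms-modified {r = r} _ r∈ pt∈) inU justified y∈
    with ∈-atomsR-modifyR⁻ r y∈
  ... | c , c∈ , inj₁ refl = embA-admissible (modified-instance-relevant σ inh r∈ pt∈ inU justified c∈)
  ... | c , c∈ , inj₂ refl = magicA-admissible (modified-instance-relevant σ inh r∈ pt∈ inU justified c∈)
  inhabited-instance-admissible σ inh (dms-magic _ r∈ pt∈ qs∈ _ _) inU justified (here refl) =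
    magicA-admissible (magic-instance-relevant σ inh r∈ pt∈ qs∈ inU justified)
  inhabited-instance-admissible σ inh (dms-magic _ _ _ _ _ _) _ (justified ∷ []) (there (here refl)) =
    magicA-admissible (justified inh)

  instance-admissible : ∀ σ {ρ y} → D ρ → InstanceInU σ ρ → JustifiedBody σ ρ
    → y ∈ atomsR ρ → substA σ y ∈ admissibleAtoms
  instance-admissible σ {ρ} dρ inU justified y∈ with ground-or-inhabited σ ρ inU y∈
  ... | inj₁ g   = ground-instance-admissible σ dρ y∈ g
  ... | inj₂ inh = inhabited-instance-admissible σ inh dρ inU justified y∈

  instance-head-Justified : ∀ σ {ρ} → D ρ → InstanceInU σ ρ → JustifiedBody σ ρ
                          → All Justified (head (substR σ ρ))
  instance-head-Justified σ dms-seed _ _ =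
    (λ _ → subst Rel (sym (substA-ground σ (InUs⇒GroundTs isQ))) rel-Q) ∷ []
  instance-head-Justified σ (dms-modified {r = r} _ _ _) _ _ =
    subst (All Justified) (sym (substAs-embAs σ (head r))) (embAs-Justified _)
  instance-head-Justified σ (dms-edb {r} _) _ _ =
    subst (All Justified) (sym (substAs-embAs σ (head r))) (embAs-Justified _)
  instance-head-Justified σ (dms-magic _ r∈ pt∈ qs∈ _ _) inU justified =
    (λ inh → magic-instance-relevant σ inh r∈ pt∈ qs∈ inU justified) ∷ []

  EDB-head-Justified : ∀ {ρ} → EDB D ρ → All Justified (head ρ)
  EDB-head-Justified (dms-seed , _)                    = (λ _ → rel-Q) ∷ []
  EDB-head-Justified (dms-modified {r = r} _ _ _ , _)  = embAs-Justified (head r)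
  EDB-head-Justified (dms-edb {r} _ , _)               = embAs-Justified (head r)
  EDB-head-Justified (dρ@(dms-magic _ _ _ _ _ _) , ¬idb ∷ _) =
    contradiction (_ , dρ , here refl , λ { (_ , _ , () , _) }) ¬idb

  admissibleRules : List (Rule MPred)
  admissibleRules = concatMap (rulesWithin admissibleAtoms) dmsRules

  Admissible : Rule MPred → Set
  Admissible r = r ∈ admissibleRules × All Justified (head r)

  rulesWithin-admissible : ∀ {ρ r} → D ρ → r ∈ rulesWithin admissibleAtoms ρ → r ∈ admissibleRules
  rulesWithin-admissible dρ r∈ = ∈-concatMap⁺ (rulesWithin admissibleAtoms) (lose (DMS-listed dρ) r∈)

  EDB⊆Admissible : EDB D ⊆ Admissible
  EDB⊆Admissible edb@(dρ , _) =
    rulesWithin-admissible dρ (∈-rulesWithin-self (All.tabulate (dmsAtom-admissible dρ))) ,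
    EDB-head-Justified edb

  Φ⊆Admissible : ∀ pre c {R S} → R ⊆ Admissible → S ⊆ Admissible → FG.Φ D pre c R S ⊆ Admissible
  Φ⊆Admissible pre c R⊆ S⊆
    (_ , (ρ , (dρ , _) , ((σ , refl) , inU) , body) , _ , head≡ , pos⊆ , neg⊆) =
    rulesWithin-admissible dρ
      (∈-rulesWithin-instance σ head≡ (FilterRel⇒⊆ pos⊆) (FilterRel⇒⊆ neg⊆)
        (All-atomsR-substR⁺ σ ρ (instance-admissible σ dρ inU justified))) ,
    subst (All Justified) (sym head≡) (instance-head-Justified σ dρ inU justified)
    where
      justified : JustifiedBody σ ρ
      justified = All.map (λ { (_ , inj₁ x , a∈) → All.lookup (proj₂ (R⊆ x)) a∈
                             ; (_ , inj₂ x , a∈) → All.lookup (proj₂ (S⊆ x)) a∈ }) body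

theorem4 : (P : List (Rule ℕ)) (Q : Atom ℕ)
         → ASPfs P → IsQuery P Q → FinitelyRecursive Q P
         → FinitelyGround (DMS Q P)
theorem4 P Q asp isQ fr γ _ =
  admissibleRules , λ _ → proj₁ ∘ Instantiation⊆ (DMS Q P) Admissible EDB⊆Admissible Φ⊆Admissible γ
  where open DMSInstantiation P Q asp isQ fr
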